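{- $sp(n,m)$ is odd for all integers $n\ge 0$ and $m>1$.
   Context: For fixed $m>1$, $sp(n,m)$ is defined by: $sp(n,m)=0$ for $n<0$, $sp(0,m)=1$, $sp(n,m)=1$ for $1\le n\le m-1$, and for $n\ge m$: $sp(n,m)=sp(n/m,m)$ if $m\mid n$, and $sp(n,m)=2sp(n-r,m)+sp(n-m,m)$ if $n\equiv r\pmod m$ with $0<r<m$. (It counts semi-$m$-Pell compositions of $n$.) -}

module Defs where

open import Data.Nat using (ℕ; zero; suc; _+_; _*_; _∸_; _<?_)
open import Data.Nat.DivMod using (_/_; _%_)
open import Relation.Nullary using (yes; no)

-- Fuelled evaluation of sp(n, m) with m = suc (suc k) (i.e. m ≥ 2).
-- Every recursive call is on a strictly smaller n (n/m < n and n ∸ r < n,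
-- n ∸ m < n when n ≥ m ≥ 2, r > 0), so fuel suc n always suffices.
-- The case n < 0 of the paper never arises for n ≥ 0 (n - m ≥ 0 when n ≥ m).
spF : ℕ → ℕ → ℕ → ℕ
spF zero    n k = 1   -- unreachable when fuel > n
spF (suc f) n k with n <? suc (suc k)
... | yes _ = 1        -- covers sp(0,m)=1 and sp(n,m)=1 for 1 ≤ n ≤ m-1
... | no  _ with n % suc (suc k)
...   | zero  = spF f (n / suc (suc k)) k
...   | suc r = 2 * spF f (n ∸ suc r) k + spF f (n ∸ suc (suc k)) k

-- sp n m for m ≥ 2; for m < 2 the value is irrelevant (defined as 0).
sp : ℕ → ℕ → ℕ
sp n zero = 0
sp n (suc zero) = 0
sp n (suc (suc k)) = spF (suc n) n k

module Submission where

open import Defs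
open import Data.Nat using (ℕ; _<_; zero; suc; _*_; _+_; _<?_; s≤s; z≤n)
open import Data.Nat.DivMod using (_%_)
open import Data.Nat.Divisibility using (_∣_; _∤_; ∣m+n∣m⇒∣n; m∣m*n; >⇒∤)
open import Relation.Nullary using (¬_; yes; no)

-- Every branch of the recursion either returns 1, recurses without changing the value,
-- or returns 2 a + b with b a value of the recursion; so oddness is preserved for any fuel.

2∤1 : 2 ∤ 1
2∤1 = >⇒∤ (s≤s (s≤s z≤n))

∤n⇒∤d*m+n : ∀ {d n} m → d ∤ n → d ∤ d * m + n
∤n⇒∤d*m+n m d∤n d∣d*m+n = d∤n (∣m+n∣m⇒∣n d∣d*m+n (m∣m*n m))

2∤spF : ∀ fuel n k → 2 ∤ spF fuel n k
2∤spF zero    n k = 2∤1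
2∤spF (suc f) n k with n <? suc (suc k)
... | yes _ = 2∤1
... | no  _ with n % suc (suc k)
...   | zero  = 2∤spF f _ k
...   | suc r = ∤n⇒∤d*m+n (spF f _ k) (2∤spF f _ k)

lemma4p1 : (n m : ℕ) → 1 < m → ¬ (2 ∣ sp n m)
lemma4p1 n (suc zero)    (s≤s ())
lemma4p1 n (suc (suc k)) _ = 2∤spF (suc n) n k
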